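{- Let $F$ be a Boolean circuit, $(T,\mathbf{G})$ a type-respecting simplified clique decomposition of $F$, and $F^*$ the circuit constructed from them as in the context. For each label $S$ of $(T,\mathbf{G})$, $f(oand(S),F^*)$ is the conjunction of the functions $f(g,F^*)$ over all original gates $g$ contained in $S$, and $f(oor(S),F^*)$ is the disjunction of these functions.
   Context: Boolean circuits over $\{\vee,\wedge,\neg\}$ (input gates, NOT gates with one input, AND/OR gates with positive fan-in, no constants). Labeled directed graph $(V,E,\mathbf{S})$: $\mathbf{S}$ a partition of $V$ into labels. Simplified clique decomposition (SCD) $(T,\mathbf{G})$: rooted tree, nodes with at most two children, each node $t$ carrying $G(t)$; leaf: $(\{v\},\emptyset,\{\{v\}\})$; two children: union of vertex-disjoint graphs; one child $t_1$: $G(t_1)$ modified by adding a new vertex as a singleton label, by union of two labels $S_1,S_2$ into $S$ ($S_1,S_2$ children of $S$), or by adding all arcs from label $S_1$ to label $S_2$ ("arc from $S_1$ to $S_2$"). The labels of $(T,\mathbf{G})$ are all elements of $\bigcup_t\mathbf{S}(G(t))$. It is an SCD of $F$ if the unlabeled root graph is the DAG of $F$; type-respecting if every non-singleton label is unary (input/NOT gates only), AND (AND gates only) or OR (OR gates only); singleton labels take the type of their gate. Construction of $F^*$: singleton $\{g\}$ gives original gate $g$ with $oand=oor=in=g$; non-singleton $S$ gets AND gate $oand(S)$, OR gate $oor(S)$, and if $S$ has no input gates a gate $in(S)$ (AND for AND labels, OR for OR labels, two chained NOT gates for unary labels). Wires: $oand(S_1)\to oand(S_2)$, $oor(S_1)\to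 oor(S_2)$ when $S_1$ is a child of $S_2$; $in(S_2)\to in(S_1)$ when $S_1$ is a child of $S_2$ and $S_2$ has no input gates; for each arc from $S_1$ to $S_2$: $oand(S_1)\to in(S_2)$ if $S_2$ is an AND label, $oor(S_1)\to in(S_2)$ if an OR label, one arbitrary of $oand(S_1),oor(S_1)$ to $in(S_2)$ if $S_2$ is a unary label of NOT gates only. Finally $in(S)$ gates without inputs are iteratively removed. $F^*$ is acyclic, and $f(g,F^*)$ denotes the Boolean function of the input variables computed at the output of gate $g$ in $F^*$. -}

module Defs where

open import Data.Nat using (ℕ)
open import Data.Bool using (Bool; true; false; not; _∧_; if_then_else_)
import Data.Bool as B
open import Data.Fin using (Fin; zero; suc)
open import Data.Fin.Subset using (Subset; _∈_; _∉_; ⁅_⁆; _∪_)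
open import Data.Vec using ([]; _∷_)
open import Data.Vec.Properties using (≡-dec)
open import Data.List using (List; []; _∷_; _++_; filter)
open import Data.List.Membership.Propositional renaming (_∈_ to _∈L_; _∉_ to _∉L_)
open import Data.List.Relation.Unary.Any using (Any)
open import Data.Maybe using (Maybe; just; nothing)
import Data.Maybe as M
open import Data.Product using (∃-syntax; _×_)
open import Data.Sum using (_⊎_)
open import Data.Empty using (⊥)
open import Data.Unit using (⊤)
open import Relation.Nullary using (¬_; ¬?)
open import Relation.Nullary.Decidable using (_×-dec_)
open import Relation.Binary.PropositionalEquality using (_≡_; _≢_)
open import Induction.WellFounded using (WellFounded)
open import Function.Bundles using (_⇔_)

-- Boolean circuits over {∨, ∧, ¬}; gates are Fin n.
-- wire u v : there is a wire from gate u into gate v (u is an input of v).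

data GType : Set where
  input notG andG orG : GType

record Circuit (n : ℕ) : Set₁ where
  field
    gtype       : Fin n → GType
    wire        : Fin n → Fin n → Set
    input-fanin : ∀ g → gtype g ≡ input → ∀ u → ¬ wire u g
    not-fanin   : ∀ g → gtype g ≡ notG →
                  ∃[ u ] (wire u g × (∀ u' → wire u' g → u' ≡ u))
    andor-fanin : ∀ g → (gtype g ≡ andG ⊎ gtype g ≡ orG) → ∃[ u ] wire u g
    acyclic     : WellFounded wire
open Circuit public

-- Simplified clique decompositions, as a tree of operations.
-- Labels are subsets of the vertex set Fin n.

data SCD (n : ℕ) : Set where
  leaf  : Fin n → SCD n                          -- ({v}, ∅, {{v}})
  union : SCD n → SCD n → SCD n                  -- disjoint union
  addv  : Fin n → SCD n → SCD n                  -- add new vertex as singleton label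
  merge : Subset n → Subset n → SCD n → SCD n    -- union of labels S₁,S₂ into S₁ ∪ S₂
  arc   : Subset n → Subset n → SCD n → SCD n    -- all arcs from label S₁ to label S₂

emptyB : ∀ {m} → Subset m → Bool
emptyB []      = true
emptyB (b ∷ s) = not b ∧ emptyB s

single? : ∀ {m} → Subset m → Maybe (Fin m)
single? []          = nothing
single? (true ∷ s)  = if emptyB s then just zero else nothing
single? (false ∷ s) = M.map suc (single? s)


module _ {n : ℕ} where

  _≟S_ : (p q : Subset n) → Relation.Nullary.Dec (p ≡ q)
  _≟S_ = ≡-dec B._≟_

  verts : SCD n → Subset n
  verts (leaf v)      = ⁅ v ⁆
  verts (union a b)   = verts a ∪ verts b
  verts (addv v t)    = ⁅ v ⁆ ∪ verts t
  verts (merge _ _ t) = verts t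
  verts (arc _ _ t)   = verts t

  Arcs : SCD n → Fin n → Fin n → Set
  Arcs (leaf v)      u w = ⊥
  Arcs (union a b)   u w = Arcs a u w ⊎ Arcs b u w
  Arcs (addv v t)    u w = Arcs t u w
  Arcs (merge _ _ t) u w = Arcs t u w
  Arcs (arc A B t)   u w = Arcs t u w ⊎ (u ∈ A × w ∈ B)

  labels : SCD n → List (Subset n)
  labels (leaf v)      = ⁅ v ⁆ ∷ []
  labels (union a b)   = labels a ++ labels b
  labels (addv v t)    = ⁅ v ⁆ ∷ labels t
  labels (merge A B t) =
    (A ∪ B) ∷ filter (λ S → ¬? (S ≟S A) ×-dec ¬? (S ≟S B)) (labels t)
  labels (arc _ _ t)   = labels t

  WF : SCD n → Set
  WF (leaf v)      = ⊤
  WF (union a b)   = WF a × WF b × (∀ v → v ∈ verts a → v ∉ verts b)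
  WF (addv v t)    = WF t × v ∉ verts t
  WF (merge A B t) = WF t × A ∈L labels t × B ∈L labels t × A ≢ B
  WF (arc A B t)   = WF t × A ∈L labels t × B ∈L labels t

  nodes : SCD n → List (SCD n)
  nodes t@(leaf _)      = t ∷ []
  nodes t@(union a b)   = t ∷ nodes a ++ nodes b
  nodes t@(addv _ s)    = t ∷ nodes s
  nodes t@(merge _ _ s) = t ∷ nodes s
  nodes t@(arc _ _ s)   = t ∷ nodes s

  IsLabel : SCD n → Subset n → Set
  IsLabel t S = Any (λ s → S ∈L labels s) (nodes t)

  mergeAt : SCD n → Subset n → Subset n → Set
  mergeAt (merge A B _) S₁ S = S ≡ A ∪ B × (S₁ ≡ A ⊎ S₁ ≡ B)
  mergeAt _ _ _ = ⊥

  arcAt : SCD n → Subset n → Subset n → Set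
  arcAt (arc A B _) S₁ S₂ = S₁ ≡ A × S₂ ≡ B
  arcAt _ _ _ = ⊥

  Child : SCD n → Subset n → Subset n → Set
  Child t S₁ S = Any (λ s → mergeAt s S₁ S) (nodes t)

  ArcOp : SCD n → Subset n → Subset n → Set
  ArcOp t S₁ S₂ = Any (λ s → arcAt s S₁ S₂) (nodes t)

module _ {n : ℕ} (F : Circuit n) where

  AllOf : GType → Subset n → Set
  AllOf k S = ∀ g → g ∈ S → gtype F g ≡ k

  IsUnaryType : GType → Set
  IsUnaryType k = k ≡ input ⊎ k ≡ notG

  NoInput : Subset n → Set
  NoInput S = ∀ g → g ∈ S → gtype F g ≢ input

  IsSCDOf : SCD n → Set
  IsSCDOf t = WF t × (∀ g → g ∈ verts t) × (∀ u v → wire F u v ⇔ Arcs t u v)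

  TypeRespecting : SCD n → Set
  TypeRespecting t = ∀ S → IsLabel t S →
    (∀ g → g ∈ S → IsUnaryType (gtype F g)) ⊎ AllOf andG S ⊎ AllOf orG S

-- Gates:
--   orig g   : original gate g of F
--   oand S   : oand(S) for non-singleton S
--   oor S    : oor(S)  for non-singleton S
--   inA S    : in(S) (for a unary label: the second, output-side NOT gate)
--   inB S    : for a unary label: the first, input-side NOT gate of in(S)

data Gate* (n : ℕ) : Set where
  orig : Fin n → Gate* n
  oand oor inA inB : Subset n → Gate* n

module _ {n : ℕ} where

  oandOf : Subset n → Gate* n
  oandOf S = M.maybe′ orig (oand S) (single? S)

  oorOf : Subset n → Gate* n
  oorOf S = M.maybe′ orig (oor S) (single? S)

  -- where wires leave in(S)
  inOut : Subset n → Gate* n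
  inOut S = M.maybe′ orig (inA S) (single? S)

-- pick S₁ S₂ is the arbitrary choice made for an arc from S₁ into a label
-- S₂ of NOT gates only: true = use oand(S₁), false = use oor(S₁).
module Construction {n : ℕ} (F : Circuit n) (t : SCD n)
                    (pick : Subset n → Subset n → Bool) where

  NonSingleton : Subset n → Set
  NonSingleton S = single? S ≡ nothing

  -- InIn S x : x is the gate of in(S) into which wires enter
  data InIn (S : Subset n) : Gate* n → Set where
    in-single : ∀ {g} → single? S ≡ just g → InIn S (orig g)
    in-andor  : NonSingleton S → (AllOf F andG S ⊎ AllOf F orG S) → InIn S (inA S)
    in-not    : NonSingleton S → AllOf F notG S → InIn S (inB S)

  -- wires of F* before the removal step
  data Wire : Gate* n → Gate* n → Set where
    w-oand    : ∀ {S₁ S₂} → Child t S₁ S₂ → Wire (oandOf S₁) (oandOf S₂)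
    w-oor     : ∀ {S₁ S₂} → Child t S₁ S₂ → Wire (oorOf S₁) (oorOf S₂)
    w-in      : ∀ {S₁ S₂ x} → Child t S₁ S₂ → NoInput F S₂ → InIn S₁ x →
                Wire (inOut S₂) x
    w-arc-and : ∀ {S₁ S₂ x} → ArcOp t S₁ S₂ → AllOf F andG S₂ → InIn S₂ x →
                Wire (oandOf S₁) x
    w-arc-or  : ∀ {S₁ S₂ x} → ArcOp t S₁ S₂ → AllOf F orG S₂ → InIn S₂ x →
                Wire (oorOf S₁) x
    w-arc-not : ∀ {S₁ S₂ x} → ArcOp t S₁ S₂ → AllOf F notG S₂ → InIn S₂ x →
                Wire (if pick S₁ S₂ then oandOf S₁ else oorOf S₁) x
    w-chain   : ∀ {S} → IsLabel t S → NonSingleton S → AllOf F notG S →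
                Wire (inB S) (inA S)

  -- gates of F* before the removal step
  Present : Gate* n → Set
  Present (orig g) = ⊤
  Present (oand S) = IsLabel t S × NonSingleton S
  Present (oor S)  = IsLabel t S × NonSingleton S
  Present (inA S)  = IsLabel t S × NonSingleton S × NoInput F S
  Present (inB S)  = IsLabel t S × NonSingleton S × AllOf F notG S

  InGate : Gate* n → Set
  InGate (inA _) = ⊤
  InGate (inB _) = ⊤
  InGate _       = ⊥

  -- iterative removal of in(S) gates without inputs (least fixpoint)
  data Removed : Gate* n → Set where
    removed : ∀ {x} → InGate x → (∀ y → Wire y x → Removed y) → Removed x

  Live : Gate* n → Set
  Live x = Present x × ¬ Removed x

  KindOf : Gate* n → GType → Set
  KindOf (orig g) k = gtype F g ≡ k
  KindOf (oand _) k = k ≡ andG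
  KindOf (oor _)  k = k ≡ orG
  KindOf (inA S)  k = (k ≡ andG × AllOf F andG S) ⊎ (k ≡ orG × AllOf F orG S)
                      ⊎ (k ≡ notG × AllOf F notG S)
  KindOf (inB _)  k = k ≡ notG

  -- val is the valuation of the gates of F* under the input assignment a
  -- (a g is the value of the input variable of input gate g)
  module _ (a : Fin n → Bool) (val : Gate* n → Bool) where

    GateSem : Gate* n → GType → Set
    GateSem x input = ∀ g → x ≡ orig g → val x ≡ a g
    GateSem x notG  = ∀ y → Wire y x → Live y → val x ≡ not (val y)
    GateSem x andG  = val x ≡ true ⇔ (∀ y → Wire y x → Live y → val y ≡ true)
    GateSem x orG   = val x ≡ true ⇔ (∃[ y ] (Wire y x × Live y × val y ≡ true))

    Consistent : Set
    Consistent = ∀ x → Live x → ∀ k → KindOf x k → GateSem x k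

module Submission where

-- The proof is by well-founded induction on labels along the child
-- relation of the decomposition.  A singleton label {g} has
-- oand = oor = g, so the claim is immediate.  A non-singleton label S was
-- created by a merge node S = A ∪ B, hence every gate of S lies in a child
-- of S, and every child is a label that is a strict subset of S (merged
-- labels are nonempty and disjoint).  In F* the only wires entering oand(S)
-- (resp. oor(S)) come from oand(S₁) (resp. oor(S₁)) for children S₁ of S,
-- so the AND/OR semantics of these gates together with the induction
-- hypothesis for the children gives the claim for S.

open import Defs
open import Data.Bool using (Bool; true; false)
open import Data.Nat using (ℕ; zero; suc; _<_)
open import Data.Nat.Induction using (<-wellFounded)
open import Data.Fin using (Fin; zero; suc)
open import Data.Fin.Subset using (Subset; _∈_; _∉_; ⁅_⁆; _∪_; _⊆_; ∣_∣) renaming (⊥ to ∅)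
open import Data.Fin.Subset.Properties
  using (x∈⁅x⁆; x∈⁅y⁆⇒x≡y; p⊆p∪q; q⊆p∪q; x∈p∪q⁻; p⊂q⇒∣p∣<∣q∣; ∪-comm; ⊆-trans)
open import Data.Vec using (_∷_; here; there)
open import Data.List.Relation.Unary.Any using (here; there)
open import Data.List.Membership.Propositional using (find; lose) renaming (_∈_ to _∈L_)
open import Data.List.Membership.Propositional.Properties
  using (∈-++⁻; ∈-++⁺ˡ; ∈-++⁺ʳ; ∈-filter⁻)
open import Data.Maybe using (just; nothing; maybe′)
open import Data.Product using (∃-syntax; _×_; _,_; proj₁; proj₂)
open import Data.Sum using (_⊎_; inj₁; inj₂; [_,_]′)
open import Data.Empty using (⊥-elim)
open import Data.Unit using (tt)
open import Relation.Binary.PropositionalEquality using (_≡_; _≢_; refl; sym; trans; cong; subst)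
open import Relation.Binary.Construct.On as On using ()
open import Induction.WellFounded using (WellFounded; module Subrelation; module All)
open import Function.Base using (_∘_)
open import Function.Bundles using (_⇔_; mk⇔; Equivalence)
open Equivalence using (to; from)

emptyB-sound : ∀ {m} (s : Subset m) → emptyB s ≡ true → ∀ x → x ∉ s
emptyB-sound (true ∷ s)  ()
emptyB-sound (false ∷ s) e zero    ()
emptyB-sound (false ∷ s) e (suc x) (there x∈s) = emptyB-sound s e x x∈s

emptyB-∅ : ∀ m → emptyB {m} ∅ ≡ true
emptyB-∅ zero    = refl
emptyB-∅ (suc m) = emptyB-∅ m

single?-sound : ∀ {m} (S : Subset m) {g} → single? S ≡ just g →
  g ∈ S × (∀ x → x ∈ S → x ≡ g)
single?-sound (true ∷ s) e with emptyB s in empty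
... | true  with refl ← e = here , λ where
  zero    _           → refl
  (suc x) (there x∈s) → ⊥-elim (emptyB-sound s empty x x∈s)
... | false with () ← e
single?-sound (false ∷ s) e with single? s in single
... | just h  with refl ← e =
  let h∈s , unique = single?-sound s single in
  there h∈s , λ where
    zero    ()
    (suc x) (there x∈s) → cong suc (unique x x∈s)
... | nothing with () ← e

single?-⁅⁆ : ∀ {m} (v : Fin m) → single? ⁅ v ⁆ ≡ just v
single?-⁅⁆ {suc m} zero    rewrite emptyB-∅ m    = refl
single?-⁅⁆ {suc m} (suc v) rewrite single?-⁅⁆ v = refl

∣∣<∣∪∣ : ∀ {m} (A B : Subset m) → ∃[ y ] y ∈ B → (∀ y → y ∈ A → y ∉ B) →
  ∣ A ∣ < ∣ A ∪ B ∣
∣∣<∣∪∣ A B (y , y∈B) disjoint =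
  p⊂q⇒∣p∣<∣q∣ (p⊆p∪q B , y , q⊆p∪q A B y∈B , λ y∈A → disjoint y y∈A y∈B)

module _ {n : ℕ} where

  node-self : (s : SCD n) → s ∈L nodes s
  node-self (leaf _)      = here refl
  node-self (union _ _)   = here refl
  node-self (addv _ _)    = here refl
  node-self (merge _ _ _) = here refl
  node-self (arc _ _ _)   = here refl

  node-trans : ∀ {s u} (t : SCD n) → s ∈L nodes t → u ∈L nodes s → u ∈L nodes t
  node-trans (leaf _)      (here refl) u∈s = u∈s
  node-trans (union a b)   (here refl) u∈s = u∈s
  node-trans (union a b)   (there s∈) u∈s with ∈-++⁻ (nodes a) s∈
  ... | inj₁ s∈a = there (∈-++⁺ˡ (node-trans a s∈a u∈s))
  ... | inj₂ s∈b = there (∈-++⁺ʳ (nodes a) (node-trans b s∈b u∈s))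
  node-trans (addv _ s)    (here refl) u∈s = u∈s
  node-trans (addv _ s)    (there s∈) u∈s = there (node-trans s s∈ u∈s)
  node-trans (merge _ _ s) (here refl) u∈s = u∈s
  node-trans (merge _ _ s) (there s∈) u∈s = there (node-trans s s∈ u∈s)
  node-trans (arc _ _ s)   (here refl) u∈s = u∈s
  node-trans (arc _ _ s)   (there s∈) u∈s = there (node-trans s s∈ u∈s)

  WF-node : ∀ {s} (t : SCD n) → WF t → s ∈L nodes t → WF s
  WF-node (leaf _)      w (here refl) = w
  WF-node (union a b)   w (here refl) = w
  WF-node (union a b)   (wa , wb , _) (there s∈) with ∈-++⁻ (nodes a) s∈
  ... | inj₁ s∈a = WF-node a wa s∈a
  ... | inj₂ s∈b = WF-node b wb s∈b
  WF-node (addv _ s)    w (here refl) = w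
  WF-node (addv _ s)    w (there s∈) = WF-node s (proj₁ w) s∈
  WF-node (merge _ _ s) w (here refl) = w
  WF-node (merge _ _ s) w (there s∈) = WF-node s (proj₁ w) s∈
  WF-node (arc _ _ s)   w (here refl) = w
  WF-node (arc _ _ s)   w (there s∈) = WF-node s (proj₁ w) s∈

  merge-label⁻ : ∀ {A B S} (s : SCD n) → S ∈L labels (merge A B s) →
    S ≡ A ∪ B ⊎ (S ∈L labels s × S ≢ A × S ≢ B)
  merge-label⁻ s (here refl) = inj₁ refl
  merge-label⁻ s (there S∈)  = inj₂ (∈-filter⁻ _ {xs = labels s} S∈)

  record LabelInv (s : SCD n) : Set where
    field
      nonempty : ∀ S → S ∈L labels s → ∃[ x ] x ∈ S
      ⊆verts   : ∀ S → S ∈L labels s → S ⊆ verts s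
      disjoint : ∀ S T → S ∈L labels s → T ∈L labels s → ∀ x → x ∈ S → x ∈ T → S ≡ T
  open LabelInv

  labelInv-leaf : ∀ v → LabelInv (leaf v)
  labelInv-leaf v = record
    { nonempty = λ { _ (here refl) → v , x∈⁅x⁆ v }
    ; ⊆verts   = λ { _ (here refl) x∈ → x∈ }
    ; disjoint = λ { _ _ (here refl) (here refl) _ _ _ → refl } }

  -- Invariant for a union: labels of the two sides live on disjoint vertex sets.
  labelInv-union : ∀ a b → (∀ v → v ∈ verts a → v ∉ verts b) →
    LabelInv a → LabelInv b → LabelInv (union a b)
  labelInv-union a b apart ia ib = record
    { nonempty = λ S S∈ → [ nonempty ia S , nonempty ib S ]′ (∈-++⁻ (labels a) S∈)
    ; ⊆verts   = λ S S∈ → [ (λ S∈a → ⊆-trans (⊆verts ia S S∈a) (p⊆p∪q (verts b)))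
                          , (λ S∈b → ⊆-trans (⊆verts ib S S∈b) (q⊆p∪q (verts a) (verts b))) ]′
                          (∈-++⁻ (labels a) S∈)
    ; disjoint = sameLabel }
    where
    sameLabel : ∀ S T → S ∈L labels (union a b) → T ∈L labels (union a b) →
      ∀ x → x ∈ S → x ∈ T → S ≡ T
    sameLabel S T S∈ T∈ x x∈S x∈T with ∈-++⁻ (labels a) S∈ | ∈-++⁻ (labels a) T∈
    ... | inj₁ S∈a | inj₁ T∈a = disjoint ia S T S∈a T∈a x x∈S x∈T
    ... | inj₂ S∈b | inj₂ T∈b = disjoint ib S T S∈b T∈b x x∈S x∈T
    ... | inj₁ S∈a | inj₂ T∈b = ⊥-elim (apart x (⊆verts ia S S∈a x∈S) (⊆verts ib T T∈b x∈T))
    ... | inj₂ S∈b | inj₁ T∈a = ⊥-elim (apart x (⊆verts ia T T∈a x∈T) (⊆verts ib S S∈b x∈S))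

  labelInv-addv : ∀ v s → v ∉ verts s → LabelInv s → LabelInv (addv v s)
  labelInv-addv v s fresh is = record
    { nonempty = λ { _ (here refl) → v , x∈⁅x⁆ v ; S (there S∈) → nonempty is S S∈ }
    ; ⊆verts   = λ { _ (here refl) x∈ → p⊆p∪q (verts s) x∈
                   ; S (there S∈) x∈ → q⊆p∪q ⁅ v ⁆ (verts s) (⊆verts is S S∈ x∈) }
    ; disjoint = sameLabel }
    where
    old∌v : ∀ T → T ∈L labels s → ∀ x → x ∈ ⁅ v ⁆ → x ∉ T
    old∌v T T∈ x x∈v x∈T with refl ← x∈⁅y⁆⇒x≡y v x∈v = fresh (⊆verts is T T∈ x∈T)
    sameLabel : ∀ S T → S ∈L labels (addv v s) → T ∈L labels (addv v s) →
      ∀ x → x ∈ S → x ∈ T → S ≡ T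
    sameLabel _ _ (here refl) (here refl) _ _   _   = refl
    sameLabel S T (there S∈)  (there T∈)  x x∈S x∈T = disjoint is S T S∈ T∈ x x∈S x∈T
    sameLabel _ T (here refl) (there T∈)  x x∈S x∈T = ⊥-elim (old∌v T T∈ x x∈S x∈T)
    sameLabel S _ (there S∈)  (here refl) x x∈S x∈T = ⊥-elim (old∌v S S∈ x x∈T x∈S)

  labelInv-merge : ∀ A B s → A ∈L labels s → B ∈L labels s →
    LabelInv s → LabelInv (merge A B s)
  labelInv-merge A B s A∈ B∈ is = record
    { nonempty = λ S S∈ → [ (λ { refl → let x , x∈A = nonempty is A A∈ in x , p⊆p∪q B x∈A })
                          , (λ old → nonempty is S (proj₁ old)) ]′ (merge-label⁻ s S∈)
    ; ⊆verts   = λ S S∈ → [ (λ { refl x∈ → [ ⊆verts is A A∈ , ⊆verts is B B∈ ]′ (x∈p∪q⁻ A B x∈) })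
                          , (λ old → ⊆verts is S (proj₁ old)) ]′ (merge-label⁻ s S∈)
    ; disjoint = sameLabel }
    where
    old∌ : ∀ T → T ∈L labels s × T ≢ A × T ≢ B → ∀ x → x ∈ A ∪ B → x ∉ T
    old∌ T (T∈ , T≢A , T≢B) x x∈ x∈T with x∈p∪q⁻ A B x∈
    ... | inj₁ x∈A = T≢A (disjoint is T A T∈ A∈ x x∈T x∈A)
    ... | inj₂ x∈B = T≢B (disjoint is T B T∈ B∈ x x∈T x∈B)
    sameLabel : ∀ S T → S ∈L labels (merge A B s) → T ∈L labels (merge A B s) →
      ∀ x → x ∈ S → x ∈ T → S ≡ T
    sameLabel S T S∈ T∈ x x∈S x∈T with merge-label⁻ s S∈ | merge-label⁻ s T∈
    ... | inj₁ refl | inj₁ refl = refl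
    ... | inj₂ oldS | inj₂ oldT = disjoint is S T (proj₁ oldS) (proj₁ oldT) x x∈S x∈T
    ... | inj₁ refl | inj₂ oldT = ⊥-elim (old∌ T oldT x x∈S x∈T)
    ... | inj₂ oldS | inj₁ refl = ⊥-elim (old∌ S oldS x x∈T x∈S)

  labelInv : ∀ s → WF s → LabelInv s
  labelInv (leaf v)      _                  = labelInv-leaf v
  labelInv (union a b)   (wa , wb , apart)  =
    labelInv-union a b apart (labelInv a wa) (labelInv b wb)
  labelInv (addv v s)    (ws , fresh)       = labelInv-addv v s fresh (labelInv s ws)
  labelInv (merge A B s) (ws , A∈ , B∈ , _) = labelInv-merge A B s A∈ B∈ (labelInv s ws)
  labelInv (arc _ _ s)   (ws , _)           = record { LabelInv (labelInv s ws) }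

  -- Two distinct labels of a node are nonempty and disjoint, so each
  -- is strictly smaller than their union.
  merged-smaller : ∀ {s : SCD n} {X Y} → LabelInv s → X ∈L labels s → Y ∈L labels s → X ≢ Y →
    ∣ X ∣ < ∣ X ∪ Y ∣
  merged-smaller is X∈ Y∈ X≢Y =
    ∣∣<∣∪∣ _ _ (nonempty is _ Y∈) λ y y∈X y∈Y → X≢Y (disjoint is _ _ X∈ Y∈ y y∈X y∈Y)

  nonSingleton-merged : ∀ (s : SCD n) S → S ∈L labels s → single? S ≡ nothing →
    ∃[ A ] ∃[ B ] ∃[ s' ] (merge A B s' ∈L nodes s × S ≡ A ∪ B)
  nonSingleton-merged (leaf v) _ (here refl) ns with () ← trans (sym (single?-⁅⁆ v)) ns
  nonSingleton-merged (union a b) S S∈ ns with ∈-++⁻ (labels a) S∈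
  ... | inj₁ S∈a = let A , B , s' , m∈ , eq = nonSingleton-merged a S S∈a ns
                   in A , B , s' , there (∈-++⁺ˡ m∈) , eq
  ... | inj₂ S∈b = let A , B , s' , m∈ , eq = nonSingleton-merged b S S∈b ns
                   in A , B , s' , there (∈-++⁺ʳ (nodes a) m∈) , eq
  nonSingleton-merged (addv v s) _ (here refl) ns with () ← trans (sym (single?-⁅⁆ v)) ns
  nonSingleton-merged (addv v s) S (there S∈) ns =
    let A , B , s' , m∈ , eq = nonSingleton-merged s S S∈ ns in A , B , s' , there m∈ , eq
  nonSingleton-merged (merge A B s) S S∈ ns with merge-label⁻ s S∈
  ... | inj₁ refl = A , B , s , here refl , refl
  ... | inj₂ (S∈s , _) =
    let A' , B' , s' , m∈ , eq = nonSingleton-merged s S S∈s ns in A' , B' , s' , there m∈ , eq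
  nonSingleton-merged (arc _ _ s) S S∈ ns =
    let A , B , s' , m∈ , eq = nonSingleton-merged s S S∈ ns in A , B , s' , there m∈ , eq

module ChildRelation {n : ℕ} (t : SCD n) (wf : WF t) where
  open LabelInv

  record ProperPart (S₁ S : Subset n) : Set where
    field
      isLabel : IsLabel t S₁
      ⊆parent : S₁ ⊆ S
      smaller : ∣ S₁ ∣ < ∣ S ∣

  merge-parts : ∀ {S₁ S} s → s ∈L nodes t → mergeAt s S₁ S → ProperPart S₁ S
  merge-parts (merge A B s) s∈ (refl , S₁≡) with WF-node t wf s∈
  ... | ws , A∈ , B∈ , A≢B = [ left , right ]′ S₁≡
    where
    is    = labelInv s ws
    below = node-trans t s∈ (there (node-self s))
    left : ∀ {S₁} → S₁ ≡ A → ProperPart S₁ (A ∪ B)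
    left refl = record
      { isLabel = lose below A∈
      ; ⊆parent = p⊆p∪q B
      ; smaller = merged-smaller is A∈ B∈ A≢B }
    right : ∀ {S₁} → S₁ ≡ B → ProperPart S₁ (A ∪ B)
    right refl = record
      { isLabel = lose below B∈
      ; ⊆parent = q⊆p∪q A B
      ; smaller = subst (λ U → ∣ B ∣ < ∣ U ∣) (∪-comm B A) (merged-smaller is B∈ A∈ (A≢B ∘ sym)) }

  child-part : ∀ {S₁ S} → Child t S₁ S → ProperPart S₁ S
  child-part c = let s , s∈ , m = find c in merge-parts s s∈ m

  -- Since children are strictly smaller, induction along children is sound.
  child-wellFounded : WellFounded (Child t)
  child-wellFounded =
    Subrelation.wellFounded (λ c → ProperPart.smaller (child-part c))
      (On.wellFounded ∣_∣ <-wellFounded)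

  child-cover : ∀ S → IsLabel t S → single? S ≡ nothing → ∀ g → g ∈ S →
    ∃[ S₁ ] (Child t S₁ S × g ∈ S₁)
  child-cover S S-label ns g g∈S with find S-label
  ... | s , s∈ , S∈s with nonSingleton-merged s S S∈s ns
  ...   | A , B , s' , m∈ , refl with x∈p∪q⁻ A B g∈S
  ...     | inj₁ g∈A = A , lose (node-trans t s∈ m∈) (refl , inj₁ refl) , g∈A
  ...     | inj₂ g∈B = B , lose (node-trans t s∈ m∈) (refl , inj₂ refl) , g∈B

module Wiring {n : ℕ} (F : Circuit n) (t : SCD n) (pick : Subset n → Subset n → Bool) where
  open Construction F t pick

  -- oand(S) and oor(S) are not in-gates, so the removal step keeps them.
  live-oand : ∀ S → IsLabel t S → NonSingleton S → Live (oand S)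
  live-oand S S-label ns = (S-label , ns) , λ { (removed () _) }

  live-oor : ∀ S → IsLabel t S → NonSingleton S → Live (oor S)
  live-oor S S-label ns = (S-label , ns) , λ { (removed () _) }

  live-oandOf : ∀ S → IsLabel t S → Live (oandOf S)
  live-oandOf S S-label with single? S in ns
  ... | just _  = tt , λ { (removed () _) }
  ... | nothing = live-oand S S-label ns

  live-oorOf : ∀ S → IsLabel t S → Live (oorOf S)
  live-oorOf S S-label with single? S in ns
  ... | just _  = tt , λ { (removed () _) }
  ... | nothing = live-oor S S-label ns

  in-not-oand : ∀ {S₁ x S} → InIn S₁ x → x ≢ oand S
  in-not-oand (in-single _) ()
  in-not-oand (in-andor _ _) ()
  in-not-oand (in-not _ _) ()

  in-not-oor : ∀ {S₁ x S} → InIn S₁ x → x ≢ oor S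
  in-not-oor (in-single _) ()
  in-not-oor (in-andor _ _) ()
  in-not-oor (in-not _ _) ()

  wire-into-oand : ∀ {y x S} → Wire y x → x ≡ oand S → ∃[ S₁ ] (Child t S₁ S × y ≡ oandOf S₁)
  wire-into-oand (w-oand {S₁} {S₂} c) eq with single? S₂
  ... | nothing with refl ← eq = S₁ , c , refl
  wire-into-oand (w-oor {S₂ = S₂} _) eq with single? S₂
  ... | nothing with () ← eq
  wire-into-oand (w-in _ _ i)      eq = ⊥-elim (in-not-oand i eq)
  wire-into-oand (w-arc-and _ _ i) eq = ⊥-elim (in-not-oand i eq)
  wire-into-oand (w-arc-or _ _ i)  eq = ⊥-elim (in-not-oand i eq)
  wire-into-oand (w-arc-not _ _ i) eq = ⊥-elim (in-not-oand i eq)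

  wire-into-oor : ∀ {y x S} → Wire y x → x ≡ oor S → ∃[ S₁ ] (Child t S₁ S × y ≡ oorOf S₁)
  wire-into-oor (w-oor {S₁} {S₂} c) eq with single? S₂
  ... | nothing with refl ← eq = S₁ , c , refl
  wire-into-oor (w-oand {S₂ = S₂} _) eq with single? S₂
  ... | nothing with () ← eq
  wire-into-oor (w-in _ _ i)      eq = ⊥-elim (in-not-oor i eq)
  wire-into-oor (w-arc-and _ _ i) eq = ⊥-elim (in-not-oor i eq)
  wire-into-oor (w-arc-or _ _ i)  eq = ⊥-elim (in-not-oor i eq)
  wire-into-oor (w-arc-not _ _ i) eq = ⊥-elim (in-not-oor i eq)

oandOf-singleton : ∀ {n} (S : Subset n) {g} → single? S ≡ just g → oandOf S ≡ orig g
oandOf-singleton S single = cong (maybe′ orig (oand S)) single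

oorOf-singleton : ∀ {n} (S : Subset n) {g} → single? S ≡ just g → oorOf S ≡ orig g
oorOf-singleton S single = cong (maybe′ orig (oor S)) single

oandOf-nonSingleton : ∀ {n} (S : Subset n) → single? S ≡ nothing → oandOf S ≡ oand S
oandOf-nonSingleton S ns = cong (maybe′ orig (oand S)) ns

oorOf-nonSingleton : ∀ {n} (S : Subset n) → single? S ≡ nothing → oorOf S ≡ oor S
oorOf-nonSingleton S ns = cong (maybe′ orig (oor S)) ns

AndOrSemantics : ∀ {n} → (Gate* n → Bool) → Subset n → Set
AndOrSemantics val S =
  (val (oandOf S) ≡ true ⇔ (∀ g → g ∈ S → val (orig g) ≡ true))
  × (val (oorOf S) ≡ true ⇔ (∃[ g ] (g ∈ S × val (orig g) ≡ true)))

andOr-singleton : ∀ {n} (val : Gate* n → Bool) S {g} → single? S ≡ just g →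
  AndOrSemantics val S
andOr-singleton val S {g} single
  rewrite oandOf-singleton S single | oorOf-singleton S single =
  mk⇔ (λ vg x x∈S → transport (sym (unique x x∈S)) vg) (λ all → all g g∈S) ,
  mk⇔ (λ vg → g , g∈S , vg) (λ { (x , x∈S , vx) → transport (unique x x∈S) vx })
  where
  g∈S    = proj₁ (single?-sound S single)
  unique = proj₂ (single?-sound S single)
  transport : ∀ {x y} → x ≡ y → val (orig x) ≡ true → val (orig y) ≡ true
  transport = subst (λ z → val (orig z) ≡ true)

module Evaluation {n : ℕ} (F : Circuit n) (t : SCD n) (wf : WF t)
                  (pick : Subset n → Subset n → Bool) (a : Fin n → Bool) (val : Gate* n → Bool)
                  (consistent : Construction.Consistent F t pick a val) where
  open Construction F t pick
  open Wiring F t pick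
  open ChildRelation t wf
  open ProperPart

  module _ (S : Subset n) (S-label : IsLabel t S) (ns : NonSingleton S)
           (ih : ∀ {S₁} → Child t S₁ S → AndOrSemantics val S₁) where

    -- oand(S) is an AND gate whose inputs are the oand(S₁) of the children S₁ of S.
    oand-conj : val (oand S) ≡ true ⇔ (∀ g → g ∈ S → val (orig g) ≡ true)
    oand-conj = mk⇔ conj⇒ conj⇐
      where
      andGate : GateSem a val (oand S) andG
      andGate = consistent (oand S) (live-oand S S-label ns) andG refl
      conj⇒ : val (oand S) ≡ true → ∀ g → g ∈ S → val (orig g) ≡ true
      conj⇒ v g g∈S =
        let S₁ , c , g∈S₁ = child-cover S S-label ns g g∈S
            w = subst (Wire (oandOf S₁)) (oandOf-nonSingleton S ns) (w-oand c)
            v₁ = to andGate v (oandOf S₁) w (live-oandOf S₁ (isLabel (child-part c)))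
        in to (proj₁ (ih c)) v₁ g g∈S₁
      conj⇐ : (∀ g → g ∈ S → val (orig g) ≡ true) → val (oand S) ≡ true
      conj⇐ all = from andGate λ y w _ → childTrue (wire-into-oand w refl)
        where
        childTrue : ∀ {y} → ∃[ S₁ ] (Child t S₁ S × y ≡ oandOf S₁) → val y ≡ true
        childTrue (S₁ , c , refl) =
          from (proj₁ (ih c)) λ g g∈S₁ → all g (⊆parent (child-part c) g∈S₁)

    -- oor(S) is an OR gate whose inputs are the oor(S₁) of the children S₁ of S.
    oor-disj : val (oor S) ≡ true ⇔ (∃[ g ] (g ∈ S × val (orig g) ≡ true))
    oor-disj = mk⇔ disj⇒ disj⇐
      where
      orGate : GateSem a val (oor S) orG
      orGate = consistent (oor S) (live-oor S S-label ns) orG refl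
      disj⇒ : val (oor S) ≡ true → ∃[ g ] (g ∈ S × val (orig g) ≡ true)
      disj⇒ v = witness (to orGate v)
        where
        witness : ∃[ y ] (Wire y (oor S) × Live y × val y ≡ true) →
          ∃[ g ] (g ∈ S × val (orig g) ≡ true)
        witness (y , w , _ , vy) with wire-into-oor w refl
        ... | S₁ , c , refl =
          let g , g∈S₁ , vg = to (proj₂ (ih c)) vy in g , ⊆parent (child-part c) g∈S₁ , vg
      disj⇐ : ∃[ g ] (g ∈ S × val (orig g) ≡ true) → val (oor S) ≡ true
      disj⇐ (g , g∈S , vg) =
        let S₁ , c , g∈S₁ = child-cover S S-label ns g g∈S
            w = subst (Wire (oorOf S₁)) (oorOf-nonSingleton S ns) (w-oor c)
        in from orGate (oorOf S₁ , w , live-oorOf S₁ (isLabel (child-part c)) ,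
                        from (proj₂ (ih c)) (g , g∈S₁ , vg))

    andOr-nonSingleton : AndOrSemantics val S
    andOr-nonSingleton rewrite oandOf-nonSingleton S ns | oorOf-nonSingleton S ns =
      oand-conj , oor-disj

  andOr : ∀ S → IsLabel t S → AndOrSemantics val S
  andOr = All.wfRec child-wellFounded _ (λ S → IsLabel t S → AndOrSemantics val S) step
    where
    step : ∀ S → (∀ {S₁} → Child t S₁ S → IsLabel t S₁ → AndOrSemantics val S₁) →
      IsLabel t S → AndOrSemantics val S
    step S ih S-label = bySingleton (single? S) refl
      where
      bySingleton : ∀ m → single? S ≡ m → AndOrSemantics val S
      bySingleton (just g) single = andOr-singleton val S single
      bySingleton nothing  single =
        andOr-nonSingleton S S-label single (λ c → ih c (ProperPart.isLabel (child-part c)))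

lemma8 : ∀ {n} (F : Circuit n) (t : SCD n) → IsSCDOf F t → TypeRespecting F t →
    (pick : Subset n → Subset n → Bool) (a : Fin n → Bool) (val : Gate* n → Bool) →
    Construction.Consistent F t pick a val →
    ∀ S → IsLabel t S →
      (val (oandOf S) ≡ true ⇔ (∀ g → g ∈ S → val (orig g) ≡ true))
      × (val (oorOf S) ≡ true ⇔ (∃[ g ] (g ∈ S × val (orig g) ≡ true)))
lemma8 F t (wf , _) _ pick a val consistent = Evaluation.andOr F t wf pick a val consistent
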